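{- Let $S$ be a wildcard string of length $n$, where $n$ is a power of $2$, and let $0<\epsilon\le 0.5$. Consider the following algorithm, with $\delta=\epsilon/2$. Set $u'=u=$ the smallest power of two that is at least $1/\delta$. For every center $c$, set $\tilde R[c]\gets\min(u,r_c)$ by direct character comparisons (at most $u$ comparisons per center). Let $\mathcal A=\{iu/2 : 1\le i\le 2n/u\}$ (the anchors, in increasing order). While $u<n/2$: for each $a\in\mathcal A$, let $\ell=\max\{1,a-u\}$, $q=\min\{n,a+u\}$, compute the matching self-convolution of $S[\ell..q]$, and for every center $c$ at which $S[\ell..q]$ has a palindromic prefix or palindromic suffix, set $\tilde R[c]\gets\max\{\tilde R[c],\min(c-\ell,q-c)\}$; then set $u\gets(1+\delta)u$, and if $u\ge 2u'$, set $u'\gets 2u'$ and replace $\mathcal A$ by its elements of even rank $\mathcal A[2],\mathcal A[4],\dots$. Return $\tilde R$. The running time of this algorithm is $O\!\left(\frac{1}{\epsilon}n\log^2 n\right)$.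
   Context: A wildcard $\phi$ matches every character; characters $x,y$ match if $x=y$ or one of them is $\phi$. A string is a palindrome if it matches its reverse position-wise. Only odd-length palindromes are considered: centers are integer positions $c\in\{1,\dots,n\}$, and $r_c$ is the largest $r$ with $1\le c-r$, $c+r\le n$ and $S[c-r..c+r]$ a palindrome. $S[\ell..q]$ has a palindromic prefix centered at $c$ if $2c-\ell\le q$ and $S[\ell..2c-\ell]$ is a palindrome, and a palindromic suffix centered at $c$ if $2c-q\ge\ell$ and $S[2c-q..q]$ is a palindrome. The matching self-convolution of a string of length $m$ (reporting, for every prefix/suffix alignment with its reverse, whether they match) is computed by FFT in $O(m\log m)$ time.
   Formalization: The parameter ε takes only rational values. -}

module Defs where

open import Data.Nat as ℕ using (ℕ; zero; suc; _∸_; _^_; _⊔_; _⊓_)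
open import Data.Nat.Logarithm using (⌈log₂_⌉)
open import Data.Integer as ℤ using (ℤ; +_)
open import Data.Rational as ℚ using (ℚ; NonZero; floor; ceiling; _≤ᵇ_)
open import Data.List using (List; []; _∷_; map; upTo)
open import Data.Nat.ListAction using (sum)
open import Data.Bool using (if_then_else_)
open import Data.Maybe using (Maybe; just; nothing) renaming (map to mapMaybe)

-- Cost model (unit-cost RAM):
--  * computing R̃[c] ← min(u, r_c) by direct comparisons costs u per center;
--  * the matching self-convolution of a window of length m costs
--    m * (1 + ⌈log₂ m⌉)  (FFT, O(m log m)), which also pays for
--    scanning the m centers of the window to update R̃;
--  * every loop iteration and every anchor costs 1 unit of bookkeeping.

evens : List ℕ → List ℕ
evens []           = []
evens (_ ∷ [])     = []
evens (_ ∷ y ∷ xs) = y ∷ evens xs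

ι : ℕ → ℚ
ι k = + k ℚ./ 1

toℕ₀ : ℤ → ℕ
toℕ₀ (+ k)      = k
toℕ₀ ℤ.-[1+ _ ] = 0

-- smallest power of two that is at least 1/δ = 2/ε
-- (the smallest power of two ≥ x equals the smallest power of two ≥ ⌈x⌉)
initU : (ε : ℚ) → .{{_ : NonZero ε}} → ℕ
initU ε = 2 ^ ⌈log₂ toℕ₀ (ceiling ((ι 2) ℚ.÷ ε)) ⌉

initAnchors : (n u : ℕ) → List ℕ
initAnchors n u = map (λ j → suc j ℕ.* (u ℕ./ 2)) (upTo ((2 ℕ.* n) ℕ./ (suc (u ∸ 1))))
  where open import Data.Nat.DivMod

-- cost of processing the window around anchor a with (rational) radius u:
-- ℓ = max{1, a − u}, q = min{n, a + u}, rounded outward to integer positions.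
windowLen : (n : ℕ) (u : ℚ) (a : ℕ) → ℕ
windowLen n u a = suc (q ∸ ℓ)
  where
  ℓ = 1 ⊔ toℕ₀ (floor (ι a ℚ.- u))
  q = n ⊓ toℕ₀ (ceiling (ι a ℚ.+ u))

windowCost : (n : ℕ) (u : ℚ) (a : ℕ) → ℕ
windowCost n u a = suc (m ℕ.* suc ⌈log₂ m ⌉)
  where m = windowLen n u a

loopCost : (fuel n : ℕ) (δ u : ℚ) (u' : ℕ) (A : List ℕ) → Maybe ℕ
loopCost zero n δ u u' A =
  if ι n ℚ.÷ ι 2 ≤ᵇ u then just 0 else nothing
loopCost (suc f) n δ u u' A =
  if ι n ℚ.÷ ι 2 ≤ᵇ u then just 0
  else mapMaybe (iterCost ℕ.+_)
    (if ι (2 ℕ.* u') ≤ᵇ uNew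
       then loopCost f n δ uNew (2 ℕ.* u') (evens A)
       else loopCost f n δ uNew u' A)
  where
  iterCost = suc (sum (map (windowCost n u) A))
  uNew = (ℚ.1ℚ ℚ.+ δ) ℚ.* u

-- total running time of the algorithm on a string of length n
-- (the cost does not depend on the characters of S)
runningTime : (n : ℕ) (ε : ℚ) → .{{_ : NonZero ε}} → Maybe ℕ
runningTime n ε =
  mapMaybe (n ℕ.* u₀ ℕ.+ n ℕ.+_) (loopCost n n δ (ι u₀) u₀ (initAnchors n u₀))
  where
  δ  = ε ℚ.÷ ι 2
  u₀ = initU ε

{-# OPTIONS --safe #-}
-- The initial radius u₀ is a power of two with 1/δ ≤ u₀ and u₀ε ≤ 6, so the
-- direct comparisons cost n·u₀ = O(n/ε).  While the loop runs, consecutive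
-- anchors are u'/2 apart and the radius satisfies u ≤ 2u', so each window has
-- length O(u') and one iteration costs O(n log n).  By Bernoulli's inequality
-- (1 + δ)^u₀ ≥ 1 + u₀δ ≥ 2: the radius doubles every u₀ iterations, so it
-- passes n/2 after at most k·u₀ iterations (n = 2^k).  The total is
-- O(n/ε + k·u₀·n log n) = O(ε⁻¹ n log² n).
module Submission where

open import Defs
open import Data.Nat using (ℕ; _^_; _*_)
open import Data.Rational using (ℚ; NonZero; 0ℚ; ½)
open import Data.Product using (∃-syntax; _×_)
open import Data.Maybe using (just)
open import Relation.Binary.PropositionalEquality using (_≡_)
import Data.Nat as N
import Data.Rational as Q

open N using (zero; suc; _+_; _∸_; _≤_; _<_; z≤n; s≤s; _⊔_; _⊓_; ⌈_/2⌉; ⌊_/2⌋)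
open import Data.Nat.Properties
open import Data.Nat.DivMod using (_/_; m/n*n≤m)
open import Data.Nat.Logarithm using (⌈log₂_⌉; ⌈log₂⌉-mono-≤; ⌈log₂2^n⌉≡n)
open import Data.Nat.Logarithm.Core using (⌈log2⌉)
open import Data.Nat.ListAction using (sum)
open import Data.Nat.Tactic.RingSolver using (solve-∀)
import Data.Nat.Coprimality as Coprime
open import Data.Integer as ℤ using (ℤ; +_; -[1+_])
import Data.Integer.Properties as ℤP
open import Data.Integer.DivMod using (div-pos-is-/ℕ; n<s[n/ℕd]*d; [n/d]*d≤n)
open import Data.Integer.Solver using () renaming (module +-*-Solver to ℤ-Solver)
open Q using (mkℚ; ↥_; ↧_; 1ℚ)
import Data.Rational.Properties as QP
open import Data.Rational.Solver using () renaming (module +-*-Solver to ℚ-Solver)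
open import Algebra.Properties.Group QP.+-0-group using (⁻¹-involutive)
open import Data.Bool using (true; false; if_then_else_; T)
open import Data.Unit using (tt)
open import Data.Empty using (⊥-elim)
open import Data.Sum using (inj₁; inj₂)
open import Data.Product using (_,_)
open import Data.List using (List; []; _∷_; map; length; upTo)
open import Data.List.Properties using (length-map; length-upTo)
open import Data.Maybe using (Maybe) renaming (map to mapMaybe)
open import Data.Maybe.Relation.Unary.Any as Any using (Any; just)
open import Induction.WellFounded using (Acc; acc)
open import Relation.Binary.PropositionalEquality
  using (refl; sym; trans; cong; cong₂; subst; subst₂; module ≡-Reasoning)

-- Rational arithmetic: integers, floor and ceiling

fromℤ : ℤ → ℚ
fromℤ z = z Q./ 1

fromℤ≡mkℚ : ∀ z → fromℤ z ≡ mkℚ z 0 (Coprime.sym (Coprime.1-coprimeTo ℤ.∣ z ∣))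
fromℤ≡mkℚ (+ n)    = QP.normalize-coprime _
fromℤ≡mkℚ -[1+ n ] = cong Q.-_ (QP.normalize-coprime {suc n} _)

fromℤ≤-intro : ∀ z {p} → z ℤ.* ↧ p ℤ.≤ ↥ p → fromℤ z Q.≤ p
fromℤ≤-intro z {p} z↧p≤↥p rewrite fromℤ≡mkℚ z =
  Q.*≤* (subst (z ℤ.* ↧ p ℤ.≤_) (sym (ℤP.*-identityʳ (↥ p))) z↧p≤↥p)

fromℤ≤-elim : ∀ z {p} → fromℤ z Q.≤ p → z ℤ.* ↧ p ℤ.≤ ↥ p
fromℤ≤-elim z {p} z≤p rewrite fromℤ≡mkℚ z =
  subst (z ℤ.* ↧ p ℤ.≤_) (ℤP.*-identityʳ (↥ p)) (QP.drop-*≤* z≤p)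

<fromℤ-intro : ∀ {p} z → ↥ p ℤ.< z ℤ.* ↧ p → p Q.< fromℤ z
<fromℤ-intro {p} z ↥p<z↧p rewrite fromℤ≡mkℚ z =
  Q.*<* (subst (ℤ._< z ℤ.* ↧ p) (sym (ℤP.*-identityʳ (↥ p))) ↥p<z↧p)

fromℤ-mono-≤ : ∀ {a b} → a ℤ.≤ b → fromℤ a Q.≤ fromℤ b
fromℤ-mono-≤ {a} {b} a≤b rewrite fromℤ≡mkℚ b =
  fromℤ≤-intro a (subst (ℤ._≤ b) (sym (ℤP.*-identityʳ a)) a≤b)

fromℤ-+ : ∀ a b → fromℤ (a ℤ.+ b) ≡ fromℤ a Q.+ fromℤ b
fromℤ-+ a b rewrite fromℤ≡mkℚ a | fromℤ≡mkℚ b =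
  cong₂ (λ x y → fromℤ (x ℤ.+ y)) (sym (ℤP.*-identityʳ a)) (sym (ℤP.*-identityʳ b))

fromℤ-* : ∀ a b → fromℤ (a ℤ.* b) ≡ fromℤ a Q.* fromℤ b
fromℤ-* a b rewrite fromℤ≡mkℚ a | fromℤ≡mkℚ b = refl

fromℤ-neg : ∀ z → fromℤ (ℤ.- z) ≡ Q.- fromℤ z
fromℤ-neg (+ zero)   = refl
fromℤ-neg ℤ.+[1+ n ] = refl
fromℤ-neg -[1+ n ]   = sym (⁻¹-involutive (fromℤ ℤ.+[1+ n ]))

floor-greatest : ∀ {z} p → fromℤ z Q.≤ p → z ℤ.≤ Q.floor p
floor-greatest {z} (mkℚ n d _) z≤p =
  subst (z ℤ.≤_) q≡floor (subst (z ℤ.≤_) (ℤP.pred-suc q) (ℤP.i<j⇒i≤pred[j] z<1+q))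
  where
  q : ℤ
  q = n ℤ./ℕ suc d
  q≡floor : q ≡ n ℤ./ + suc d
  q≡floor = sym (div-pos-is-/ℕ n (suc d))
  z<1+q : z ℤ.< ℤ.suc q
  z<1+q = ℤP.*-cancelʳ-<-nonNeg (+ suc d) (ℤP.≤-<-trans (fromℤ≤-elim z z≤p) (n<s[n/ℕd]*d n (suc d)))

floor-≤ : ∀ p → fromℤ (Q.floor p) Q.≤ p
floor-≤ (mkℚ n d _) = fromℤ≤-intro (n ℤ./ + suc d) ([n/d]*d≤n n (+ suc d))

<-suc-floor : ∀ p → p Q.< fromℤ (ℤ.suc (Q.floor p))
<-suc-floor (mkℚ n d _) = <fromℤ-intro (ℤ.suc (n ℤ./ + suc d))
  (subst (λ q → n ℤ.< ℤ.suc q ℤ.* + suc d) (sym (div-pos-is-/ℕ n (suc d))) (n<s[n/ℕd]*d n (suc d)))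

ceiling-least : ∀ {z} p → p Q.≤ fromℤ z → Q.ceiling p ℤ.≤ z
ceiling-least {z} p@(mkℚ _ _ _) p≤z = subst (ℤ.- Q.floor (Q.- p) ℤ.≤_) (ℤP.neg-involutive z)
  (ℤP.neg-mono-≤ (floor-greatest (Q.- p) (subst (Q._≤ Q.- p) (sym (fromℤ-neg z)) (QP.neg-antimono-≤ p≤z))))

≤-ceiling : ∀ p → p Q.≤ fromℤ (Q.ceiling p)
≤-ceiling p@(mkℚ _ _ _) =
  subst₂ Q._≤_ (⁻¹-involutive p) (sym (fromℤ-neg (Q.floor (Q.- p)))) (QP.neg-antimono-≤ (floor-≤ (Q.- p)))

ceiling-≤-+1 : ∀ p → fromℤ (Q.ceiling p) Q.≤ p Q.+ 1ℚ
ceiling-≤-+1 p@(mkℚ _ _ _) = subst (Q._≤ p Q.+ 1ℚ) ceiling≡ (QP.+-monoˡ-≤ 1ℚ (QP.<⇒≤ below))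
  where
  f : ℤ
  f = Q.floor (Q.- p)
  below : fromℤ (ℤ.- ℤ.suc f) Q.< p
  below = subst₂ Q._<_ (sym (fromℤ-neg (ℤ.suc f))) (⁻¹-involutive p) (QP.neg-antimono-< (<-suc-floor (Q.- p)))
  ceiling≡ : fromℤ (ℤ.- ℤ.suc f) Q.+ 1ℚ ≡ fromℤ (Q.ceiling p)
  ceiling≡ = trans (sym (fromℤ-+ (ℤ.- ℤ.suc f) (+ 1)))
    (cong fromℤ (solve 1 (λ f → :- (con (+ 1) :+ f) :+ con (+ 1) := :- f) refl f))
    where open ℤ-Solver

ι-+ : ∀ a b → ι (a + b) ≡ ι a Q.+ ι b
ι-+ a b = fromℤ-+ (+ a) (+ b)

ι-* : ∀ a b → ι (a * b) ≡ ι a Q.* ι b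
ι-* a b = trans (cong fromℤ (ℤP.pos-* a b)) (fromℤ-* (+ a) (+ b))

ι-∸ : ∀ {m n} → n ≤ m → ι (m ∸ n) ≡ ι m Q.- ι n
ι-∸ {m} {n} n≤m = begin
  ι (m ∸ n)                   ≡⟨ solve 2 (λ x y → x := x :+ y :- y) refl (ι (m ∸ n)) (ι n) ⟩
  ι (m ∸ n) Q.+ ι n Q.- ι n   ≡⟨ cong (Q._- ι n) (ι-+ (m ∸ n) n) ⟨
  ι (m ∸ n + n) Q.- ι n       ≡⟨ cong (λ x → ι x Q.- ι n) (m∸n+n≡m n≤m) ⟩
  ι m Q.- ι n                 ∎
  where
  open ≡-Reasoning
  open ℚ-Solver

ι-mono-≤ : ∀ {a b} → a ≤ b → ι a Q.≤ ι b
ι-mono-≤ a≤b = fromℤ-mono-≤ (ℤ.+≤+ a≤b)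

0≤ι : ∀ k → 0ℚ Q.≤ ι k
0≤ι k = ι-mono-≤ (z≤n {k})

ι-pos⇒nonZero : ∀ {k} → 0ℚ Q.< ι k → N.NonZero k
ι-pos⇒nonZero {zero}  0<0 = ⊥-elim (QP.<-irrefl refl 0<0)
ι-pos⇒nonZero {suc k} _   = _

toℕ₀-≤ : ∀ {z k} → z ℤ.≤ + k → toℕ₀ z ≤ k
toℕ₀-≤ (ℤ.+≤+ m≤k) = m≤k
toℕ₀-≤ ℤ.-≤+       = z≤n

≤-toℕ₀ : ∀ {k z} → + k ℤ.≤ z → k ≤ toℕ₀ z
≤-toℕ₀ (ℤ.+≤+ k≤m) = k≤m

fromℤ≤ι-toℕ₀ : ∀ z → fromℤ z Q.≤ ι (toℕ₀ z)
fromℤ≤ι-toℕ₀ (+ k)    = QP.≤-refl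
fromℤ≤ι-toℕ₀ -[1+ k ] = fromℤ-mono-≤ (ℤ.-≤+ {k} {0})

ι-toℕ₀-≤ : ∀ z {q} → fromℤ z Q.≤ q → 0ℚ Q.≤ q → ι (toℕ₀ z) Q.≤ q
ι-toℕ₀-≤ (+ k)    z≤q _   = z≤q
ι-toℕ₀-≤ -[1+ k ] _   0≤q = 0≤q

*-monoʳ-≤-0≤ : ∀ {p q} r → 0ℚ Q.≤ r → p Q.≤ q → p Q.* r Q.≤ q Q.* r
*-monoʳ-≤-0≤ r 0≤r = QP.*-monoʳ-≤-nonNeg r {{Q.nonNegative 0≤r}}

*-monoˡ-≤-0≤ : ∀ {p q} r → 0ℚ Q.≤ r → p Q.≤ q → r Q.* p Q.≤ r Q.* q
*-monoˡ-≤-0≤ r 0≤r = QP.*-monoˡ-≤-nonNeg r {{Q.nonNegative 0≤r}}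

0≤-* : ∀ {p q} → 0ℚ Q.≤ p → 0ℚ Q.≤ q → 0ℚ Q.≤ p Q.* q
0≤-* {p} {q} 0≤p 0≤q = subst (Q._≤ p Q.* q) (QP.*-zeroˡ q) (*-monoʳ-≤-0≤ q 0≤q 0≤p)

p≤p+q : ∀ p {q} → 0ℚ Q.≤ q → p Q.≤ p Q.+ q
p≤p+q p {q} 0≤q = subst (Q._≤ p Q.+ q) (QP.+-identityʳ p) (QP.+-monoʳ-≤ p 0≤q)

-- Powers of two and ⌈log₂⌉

n≤2*⌈n/2⌉ : ∀ n → n ≤ 2 * ⌈ n /2⌉
n≤2*⌈n/2⌉ n = begin
  n                       ≡⟨ ⌊n/2⌋+⌈n/2⌉≡n n ⟨
  ⌊ n /2⌋ + ⌈ n /2⌉       ≤⟨ +-monoˡ-≤ ⌈ n /2⌉ (⌊n/2⌋≤⌈n/2⌉ n) ⟩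
  ⌈ n /2⌉ + ⌈ n /2⌉       ≡⟨ cong (_+_ ⌈ n /2⌉) (+-identityʳ ⌈ n /2⌉) ⟨
  2 * ⌈ n /2⌉             ∎
  where open ≤-Reasoning

n≤2^⌈log2⌉n : ∀ n (rec : Acc _<_ n) → n ≤ 2 ^ ⌈log2⌉ n rec
n≤2^⌈log2⌉n 0             _        = z≤n
n≤2^⌈log2⌉n 1             _        = ≤-refl
n≤2^⌈log2⌉n (suc (suc n)) (acc rs) = begin
  2 + n                                              ≤⟨ s≤s (s≤s (n≤2*⌈n/2⌉ n)) ⟩
  2 + 2 * ⌈ n /2⌉                                    ≡⟨ *-suc 2 ⌈ n /2⌉ ⟨
  2 * suc ⌈ n /2⌉                                    ≤⟨ *-monoʳ-≤ 2 (n≤2^⌈log2⌉n _ (rs (⌈n/2⌉<n n))) ⟩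
  2 * 2 ^ ⌈log2⌉ (suc ⌈ n /2⌉) (rs (⌈n/2⌉<n n))     ∎
  where open ≤-Reasoning

n≤2^⌈log₂n⌉ : ∀ n → n ≤ 2 ^ ⌈log₂ n ⌉
n≤2^⌈log₂n⌉ n = n≤2^⌈log2⌉n n _

2^⌈log₂n⌉<2*n : ∀ n .{{_ : N.NonZero n}} → 2 ^ ⌈log₂ n ⌉ < 2 * n
2^⌈log₂n⌉<2*n n with ⌈log₂ n ⌉ in log≡
... | zero  = *-monoʳ-≤ 2 (N.>-nonZero⁻¹ n)
... | suc q = *-monoʳ-< 2 (≰⇒> n≰2^q)
  where
  n≰2^q : n N.≰ 2 ^ q
  n≰2^q n≤2^q = 1+n≰n (begin
    suc q            ≡⟨ log≡ ⟨
    ⌈log₂ n ⌉        ≤⟨ ⌈log₂⌉-mono-≤ n≤2^q ⟩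
    ⌈log₂ 2 ^ q ⌉    ≡⟨ ⌈log₂2^n⌉≡n q ⟩
    q                ∎)
    where open ≤-Reasoning

⌈log₂1+2^k⌉≤1+k : ∀ k → ⌈log₂ (suc (2 ^ k)) ⌉ ≤ suc k
⌈log₂1+2^k⌉≤1+k k = begin
  ⌈log₂ (suc (2 ^ k)) ⌉       ≤⟨ ⌈log₂⌉-mono-≤ (+-monoˡ-≤ (2 ^ k) (m^n>0 2 k)) ⟩
  ⌈log₂ (2 ^ k + 2 ^ k) ⌉     ≡⟨ cong (λ m → ⌈log₂ (2 ^ k + m) ⌉) (+-identityʳ (2 ^ k)) ⟨
  ⌈log₂ (2 ^ suc k) ⌉         ≡⟨ ⌈log₂2^n⌉≡n (suc k) ⟩
  suc k                       ∎
  where open ≤-Reasoning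

n<2^n : ∀ n → n < 2 ^ n
n<2^n zero    = s≤s z≤n
n<2^n (suc n) = begin-strict
  suc n            <⟨ s≤s (n<2^n n) ⟩
  suc (2 ^ n)      ≤⟨ +-monoˡ-≤ (2 ^ n) (m^n>0 2 n) ⟩
  2 ^ n + 2 ^ n    ≡⟨ cong (_+_ (2 ^ n)) (+-identityʳ (2 ^ n)) ⟨
  2 * 2 ^ n        ∎
  where open ≤-Reasoning

[m∸n]*2^n≤2^m : ∀ m n → (m ∸ n) * 2 ^ n ≤ 2 ^ m
[m∸n]*2^n≤2^m m       zero    = ≤-trans (≤-reflexive (*-identityʳ m)) (<⇒≤ (n<2^n m))
[m∸n]*2^n≤2^m zero    (suc n) = z≤n
[m∸n]*2^n≤2^m (suc m) (suc n) = begin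
  (m ∸ n) * (2 * 2 ^ n)   ≡⟨ swap (m ∸ n) (2 ^ n) ⟩
  2 * ((m ∸ n) * 2 ^ n)   ≤⟨ *-monoʳ-≤ 2 ([m∸n]*2^n≤2^m m n) ⟩
  2 * 2 ^ m               ∎
  where
  open ≤-Reasoning
  swap : ∀ x y → x * (2 * y) ≡ 2 * (x * y)
  swap = solve-∀

-- Growth of the radius

grow : ℚ → ℕ → ℚ → ℚ
grow δ zero    u = u
grow δ (suc j) u = grow δ j ((1ℚ Q.+ δ) Q.* u)

grow-+ : ∀ δ i j u → grow δ (i + j) u ≡ grow δ j (grow δ i u)
grow-+ δ zero    j u = refl
grow-+ δ (suc i) j u = grow-+ δ i j ((1ℚ Q.+ δ) Q.* u)

module _ {δ : ℚ} (0≤δ : 0ℚ Q.≤ δ) where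

  0≤1+δ : 0ℚ Q.≤ 1ℚ Q.+ δ
  0≤1+δ = QP.≤-trans (QP.≤ᵇ⇒≤ tt) (QP.+-monoʳ-≤ 1ℚ 0≤δ)

  0≤grow : ∀ j {v} → 0ℚ Q.≤ v → 0ℚ Q.≤ grow δ j v
  0≤grow zero    0≤v = 0≤v
  0≤grow (suc j) 0≤v = 0≤grow j (0≤-* 0≤1+δ 0≤v)

  bernoulli : ∀ m {v} → 0ℚ Q.≤ v → (1ℚ Q.+ ι m Q.* δ) Q.* v Q.≤ grow δ m v
  bernoulli zero    {v} _   = QP.≤-reflexive (solve 2 (λ δ v → (con 1ℚ :+ con 0ℚ :* δ) :* v := v) refl δ v)
    where open ℚ-Solver
  bernoulli (suc m) {v} 0≤v = begin
    (1ℚ Q.+ ι (suc m) Q.* δ) Q.* v                  ≡⟨ cong (λ x → (1ℚ Q.+ x Q.* δ) Q.* v) (ι-+ 1 m) ⟩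
    (1ℚ Q.+ (1ℚ Q.+ ι m) Q.* δ) Q.* v
      ≤⟨ p≤p+q _ (0≤-* (0≤-* (0≤-* (0≤ι m) 0≤δ) 0≤δ) 0≤v) ⟩
    (1ℚ Q.+ (1ℚ Q.+ ι m) Q.* δ) Q.* v Q.+ ι m Q.* δ Q.* δ Q.* v
      ≡⟨ solve 3 (λ m δ v → (con 1ℚ :+ (con 1ℚ :+ m) :* δ) :* v :+ m :* δ :* δ :* v
                             := (con 1ℚ :+ m :* δ) :* ((con 1ℚ :+ δ) :* v)) refl (ι m) δ v ⟩
    (1ℚ Q.+ ι m Q.* δ) Q.* ((1ℚ Q.+ δ) Q.* v)        ≤⟨ bernoulli m (0≤-* 0≤1+δ 0≤v) ⟩
    grow δ m ((1ℚ Q.+ δ) Q.* v)                       ∎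
    where
    open QP.≤-Reasoning
    open ℚ-Solver

  grow-doubles : ∀ m {v} → 1ℚ Q.≤ ι m Q.* δ → 0ℚ Q.≤ v → ι 2 Q.* v Q.≤ grow δ m v
  grow-doubles m {v} 1≤mδ 0≤v = QP.≤-trans (*-monoʳ-≤-0≤ v 0≤v (QP.+-monoʳ-≤ 1ℚ 1≤mδ)) (bernoulli m 0≤v)

  grow-2^ : ∀ {m} → 1ℚ Q.≤ ι m Q.* δ → ∀ j {v} → 0ℚ Q.≤ v → ι (2 ^ j) Q.* v Q.≤ grow δ (j * m) v
  grow-2^     1≤mδ zero    {v} _   = QP.≤-reflexive (QP.*-identityˡ v)
  grow-2^ {m} 1≤mδ (suc j) {v} 0≤v = begin
    ι (2 * 2 ^ j) Q.* v             ≡⟨ cong (Q._* v) (ι-* 2 (2 ^ j)) ⟩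
    ι 2 Q.* ι (2 ^ j) Q.* v         ≡⟨ solve 3 (λ a b v → a :* b :* v := b :* (a :* v)) refl (ι 2) (ι (2 ^ j)) v ⟩
    ι (2 ^ j) Q.* (ι 2 Q.* v)       ≤⟨ *-monoˡ-≤-0≤ (ι (2 ^ j)) (0≤ι (2 ^ j)) (grow-doubles m 1≤mδ 0≤v) ⟩
    ι (2 ^ j) Q.* grow δ m v        ≤⟨ grow-2^ 1≤mδ j (0≤grow m 0≤v) ⟩
    grow δ (j * m) (grow δ m v)     ≡⟨ grow-+ δ m (j * m) v ⟨
    grow δ (m + j * m) v            ∎
    where
    open QP.≤-Reasoning
    open ℚ-Solver

enough-iterations : ∀ {δ} → 0ℚ Q.≤ δ → ∀ k p → 1ℚ Q.≤ ι (2 ^ p) Q.* δ →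
                    ι (2 ^ k) Q.≤ grow δ ((k ∸ p) * 2 ^ p) (ι (2 ^ p))
enough-iterations 0≤δ k p 1≤uδ = begin
  ι (2 ^ k)                             ≤⟨ ι-mono-≤ 2^k≤ ⟩
  ι (2 ^ (k ∸ p) * 2 ^ p)               ≡⟨ ι-* (2 ^ (k ∸ p)) (2 ^ p) ⟩
  ι (2 ^ (k ∸ p)) Q.* ι (2 ^ p)         ≤⟨ grow-2^ 0≤δ 1≤uδ (k ∸ p) (0≤ι (2 ^ p)) ⟩
  grow _ ((k ∸ p) * 2 ^ p) (ι (2 ^ p))  ∎
  where
  open QP.≤-Reasoning
  2^k≤ : 2 ^ k ≤ 2 ^ (k ∸ p) * 2 ^ p
  2^k≤ = ≤-trans (^-monoʳ-≤ 2 (m≤n+m∸n k p))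
           (≤-reflexive (trans (^-distribˡ-+-* 2 p (k ∸ p)) (*-comm (2 ^ p) (2 ^ (k ∸ p)))))

-- Cost of the loop

windowLen≤ : ∀ n {u} a B → u Q.≤ ι B → windowLen n u a ≤ suc (2 * B)
windowLen≤ n {u} a B u≤B = s≤s (begin
  q ∸ ℓ                  ≤⟨ ∸-mono q≤a+B a∸B≤ℓ ⟩
  (a + B) ∸ (a ∸ B)      ≤⟨ m≤n+o⇒m∸n≤o (a + B) (a ∸ B) a+B≤ ⟩
  2 * B                  ∎)
  where
  open ≤-Reasoning
  ℓ q : ℕ
  ℓ = 1 ⊔ toℕ₀ (Q.floor (ι a Q.- u))
  q = n ⊓ toℕ₀ (Q.ceiling (ι a Q.+ u))
  q≤a+B : q ≤ a + B
  q≤a+B = ≤-trans (m⊓n≤n n _) (toℕ₀-≤ (ceiling-least (ι a Q.+ u)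
            (subst (ι a Q.+ u Q.≤_) (sym (ι-+ a B)) (QP.+-monoʳ-≤ (ι a) u≤B))))
  a∸B≤ℓ : a ∸ B ≤ ℓ
  a∸B≤ℓ with ≤-total B a
  ... | inj₂ a≤B = ≤-trans (≤-reflexive (m≤n⇒m∸n≡0 a≤B)) z≤n
  ... | inj₁ B≤a = ≤-trans (≤-toℕ₀ (floor-greatest (ι a Q.- u) a∸B≤a-u)) (m≤n⊔m 1 _)
    where
    a∸B≤a-u : ι (a ∸ B) Q.≤ ι a Q.- u
    a∸B≤a-u = subst (Q._≤ ι a Q.- u) (sym (ι-∸ B≤a)) (QP.+-monoʳ-≤ (ι a) (QP.neg-antimono-≤ u≤B))
  a+B≤ : a + B ≤ (a ∸ B) + 2 * B
  a+B≤ = begin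
    a + B                  ≤⟨ +-monoˡ-≤ B (m≤n+m∸n a B) ⟩
    B + (a ∸ B) + B        ≡⟨ rearrange B (a ∸ B) ⟩
    (a ∸ B) + 2 * B        ∎
    where
    rearrange : ∀ b c → b + c + b ≡ c + 2 * b
    rearrange = solve-∀

windowLen≤suc : ∀ n u a → windowLen n u a ≤ suc n
windowLen≤suc n u a =
  s≤s (≤-trans (m∸n≤m (n ⊓ toℕ₀ (Q.ceiling (ι a Q.+ u))) (1 ⊔ toℕ₀ (Q.floor (ι a Q.- u))))
               (m⊓n≤m n _))

windowCost≤ : ∀ {n K u u'} a → ⌈log₂ (suc n) ⌉ ≤ K → 1 ≤ u' → u Q.≤ ι (2 * u') →
              windowCost n u a ≤ 6 * u' * suc K
windowCost≤ {n} {K} {u} {u'} a logn≤K 1≤u' u≤2u' = begin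
  suc (m * suc ⌈log₂ m ⌉)          ≤⟨ s≤s (*-mono-≤ m≤5u' (s≤s log≤K)) ⟩
  suc (5 * u' * suc K)             ≤⟨ +-monoˡ-≤ (5 * u' * suc K) (*-mono-≤ 1≤u' (s≤s (z≤n {K}))) ⟩
  u' * suc K + 5 * u' * suc K      ≡⟨ *-distribʳ-+ (suc K) u' (5 * u') ⟨
  6 * u' * suc K                   ∎
  where
  open ≤-Reasoning
  m : ℕ
  m = windowLen n u a
  log≤K : ⌈log₂ m ⌉ ≤ K
  log≤K = ≤-trans (⌈log₂⌉-mono-≤ (windowLen≤suc n u a)) logn≤K
  m≤5u' : m ≤ 5 * u'
  m≤5u' = ≤-trans (windowLen≤ n a (2 * u') u≤2u')
            (≤-trans (≤-reflexive (cong suc (sym (*-assoc 2 2 u')))) (+-monoˡ-≤ (4 * u') 1≤u'))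

sum-map-≤ : ∀ {a} {A : Set a} (f : A → ℕ) {c} xs → (∀ x → f x ≤ c) → sum (map f xs) ≤ length xs * c
sum-map-≤ f []       _   = z≤n
sum-map-≤ f (x ∷ xs) f≤c = +-mono-≤ (f≤c x) (sum-map-≤ f xs f≤c)

record Invariant (n : ℕ) (u : ℚ) (u' : ℕ) (A : List ℕ) : Set where
  field
    0≤u         : 0ℚ Q.≤ u
    u≤2u'       : u Q.≤ ι (2 * u')
    1≤u'        : 1 ≤ u'
    few-anchors : length A * u' ≤ 2 * n

iterationBound : ℕ → ℕ → ℕ
iterationBound n K = suc (12 * n * suc K)

iterationCost≤ : ∀ {n K u u' A} → ⌈log₂ (suc n) ⌉ ≤ K → Invariant n u u' A →
                 suc (sum (map (windowCost n u) A)) ≤ iterationBound n K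
iterationCost≤ {n} {K} {u} {u'} {A} logn≤K inv = s≤s (begin
  sum (map (windowCost n u) A)
    ≤⟨ sum-map-≤ (windowCost n u) A (λ a → windowCost≤ a logn≤K 1≤u' u≤2u') ⟩
  length A * (6 * u' * suc K)      ≡⟨ regroup (length A) u' (suc K) ⟩
  6 * suc K * (length A * u')      ≤⟨ *-monoʳ-≤ (6 * suc K) few-anchors ⟩
  6 * suc K * (2 * n)              ≡⟨ regroup′ n (suc K) ⟩
  12 * n * suc K                   ∎)
  where
  open ≤-Reasoning
  open Invariant inv
  regroup : ∀ l v s → l * (6 * v * s) ≡ 6 * s * (l * v)
  regroup = solve-∀
  regroup′ : ∀ n s → 6 * s * (2 * n) ≡ 12 * n * s
  regroup′ = solve-∀

initial-invariant : ∀ n u → 1 ≤ u → Invariant n (ι u) u (initAnchors n u)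
initial-invariant n u 1≤u = record
  { 0≤u         = 0≤ι u
  ; u≤2u'       = ι-mono-≤ (m≤m+n u (u + 0))
  ; 1≤u'        = 1≤u
  ; few-anchors = begin
      length (initAnchors n u) * u    ≡⟨ cong (_* u) (trans (length-map _ (upTo q)) (length-upTo q)) ⟩
      q * u                           ≡⟨ cong (q *_) (m+[n∸m]≡n 1≤u) ⟨
      q * suc (u ∸ 1)                 ≤⟨ m/n*n≤m (2 * n) (suc (u ∸ 1)) ⟩
      2 * n                           ∎
  }
  where
  open ≤-Reasoning
  q : ℕ
  q = (2 * n) / suc (u ∸ 1)

length-evens : ∀ xs → length (evens xs) * 2 ≤ length xs
length-evens []           = z≤n
length-evens (_ ∷ [])     = z≤n
length-evens (_ ∷ _ ∷ xs) = s≤s (s≤s (length-evens xs))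

module _ {n u u' A} {δ : ℚ} (0≤δ : 0ℚ Q.≤ δ) (inv : Invariant n u u' A) where
  open Invariant inv

  invariant-keep : (1ℚ Q.+ δ) Q.* u Q.< ι (2 * u') → Invariant n ((1ℚ Q.+ δ) Q.* u) u' A
  invariant-keep grown< = record
    { 0≤u = 0≤-* (0≤1+δ 0≤δ) 0≤u ; u≤2u' = QP.<⇒≤ grown< ; 1≤u' = 1≤u' ; few-anchors = few-anchors }

  invariant-double : δ Q.≤ 1ℚ → Invariant n ((1ℚ Q.+ δ) Q.* u) (2 * u') (evens A)
  invariant-double δ≤1 = record
    { 0≤u         = 0≤-* (0≤1+δ 0≤δ) 0≤u
    ; u≤2u'       = QP.≤-trans (*-monoʳ-≤-0≤ u 0≤u (QP.+-monoʳ-≤ 1ℚ δ≤1))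
                      (QP.≤-trans (*-monoˡ-≤-0≤ (ι 2) (0≤ι 2) u≤2u') (QP.≤-reflexive (sym (ι-* 2 (2 * u')))))
    ; 1≤u'        = ≤-trans 1≤u' (m≤m+n u' _)
    ; few-anchors = begin
        length (evens A) * (2 * u')    ≡⟨ *-assoc (length (evens A)) 2 u' ⟨
        length (evens A) * 2 * u'      ≤⟨ *-monoˡ-≤ u' (length-evens A) ⟩
        length A * u'                  ≤⟨ few-anchors ⟩
        2 * n                          ∎
    }
    where open ≤-Reasoning

if-≤ᵇ : ∀ {a ℓ} {A : Set a} (P : A → Set ℓ) p q {x y} →
        (p Q.≤ q → P x) → (q Q.< p → P y) → P (if p Q.≤ᵇ q then x else y)
if-≤ᵇ P p q {x} {y} on-≤ on-> = cases (p Q.≤ᵇ q) QP.≤ᵇ⇒≤ QP.≤⇒≤ᵇ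
  where
  cases : ∀ b → (T b → p Q.≤ q) → (p Q.≤ q → T b) → P (if b then x else y)
  cases true  sound _        = on-≤ (sound tt)
  cases false _     complete = on-> (QP.≰⇒> complete)

Any-mapMaybe : ∀ {a b p q} {A : Set a} {B : Set b} {P : A → Set p} {Q : B → Set q} {f : A → B} →
               (∀ {x} → P x → Q (f x)) → ∀ {m} → Any P m → Any Q (mapMaybe f m)
Any-mapMaybe P⇒Q (just px) = just (P⇒Q px)

Any⇒∃ : ∀ {a p} {A : Set a} {P : A → Set p} {m : Maybe A} → Any P m → ∃[ x ] (m ≡ just x × P x)
Any⇒∃ (just px) = _ , refl , px

loopCost-halted : ∀ {n δ} f {u u' A b} → ι n Q.÷ ι 2 Q.≤ u → Any (_≤ b) (loopCost f n δ u u' A)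
loopCost-halted {n} zero    {u} done = if-≤ᵇ (Any _) (ι n Q.÷ ι 2) u (λ _ → just z≤n)
  (λ u<n/2 → ⊥-elim (QP.<-irrefl refl (QP.<-≤-trans u<n/2 done)))
loopCost-halted {n} (suc f) {u} done = if-≤ᵇ (Any _) (ι n Q.÷ ι 2) u (λ _ → just z≤n)
  (λ u<n/2 → ⊥-elim (QP.<-irrefl refl (QP.<-≤-trans u<n/2 done)))

module _ {n K : ℕ} {δ : ℚ} (0≤δ : 0ℚ Q.≤ δ) (δ≤1 : δ Q.≤ 1ℚ) (logn≤K : ⌈log₂ (suc n) ⌉ ≤ K) where

  loopCost≤ : ∀ j f {u u' A} → j ≤ f → Invariant n u u' A → ι n Q.÷ ι 2 Q.≤ grow δ j u →
              Any (_≤ j * iterationBound n K) (loopCost f n δ u u' A)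
  loopCost≤ zero    f                       _         _   done  = loopCost-halted f done
  loopCost≤ (suc j) (suc f) {u} {u'} (s≤s j≤f) inv later =
    if-≤ᵇ (Any _) (ι n Q.÷ ι 2) u (λ _ → just z≤n) λ _ →
      Any-mapMaybe (+-mono-≤ (iterationCost≤ logn≤K inv))
        (if-≤ᵇ (Any _) (ι (2 * u')) ((1ℚ Q.+ δ) Q.* u)
          (λ _      → loopCost≤ j f j≤f (invariant-double 0≤δ inv δ≤1) later)
          (λ grown< → loopCost≤ j f j≤f (invariant-keep 0≤δ inv grown<) later))

module _ (ε : ℚ) .{{_ : NonZero ε}} (0<ε : 0ℚ Q.< ε) where
  private
    x : ℚ
    x = ι 2 Q.÷ ε
    c : ℕ
    c = toℕ₀ (Q.ceiling x)

    0≤ε : 0ℚ Q.≤ ε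
    0≤ε = QP.<⇒≤ 0<ε

    x*ε≡2 : x Q.* ε ≡ ι 2
    x*ε≡2 = trans (QP.*-assoc (ι 2) (Q.1/ ε) ε) (trans (cong (ι 2 Q.*_) (QP.*-inverseˡ ε)) (QP.*-identityʳ (ι 2)))

    0<x : 0ℚ Q.< x
    0<x = QP.≰⇒> λ x≤0 → QP.<-irrefl refl (QP.<-≤-trans (QP.positive⁻¹ (ι 2)) (begin
      ι 2          ≡⟨ x*ε≡2 ⟨
      x Q.* ε      ≤⟨ *-monoʳ-≤-0≤ ε 0≤ε x≤0 ⟩
      0ℚ Q.* ε     ≡⟨ QP.*-zeroˡ ε ⟩
      0ℚ           ∎))
      where open QP.≤-Reasoning

    x≤c : x Q.≤ ι c
    x≤c = QP.≤-trans (≤-ceiling x) (fromℤ≤ι-toℕ₀ (Q.ceiling x))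

    c≤x+1 : ι c Q.≤ x Q.+ 1ℚ
    c≤x+1 = ι-toℕ₀-≤ (Q.ceiling x) (ceiling-≤-+1 x) (QP.≤-trans (QP.<⇒≤ 0<x) (p≤p+q x (QP.≤ᵇ⇒≤ tt)))

    c≢0 : N.NonZero c
    c≢0 = ι-pos⇒nonZero (QP.<-≤-trans 0<x x≤c)

  initU-δ : 1ℚ Q.≤ ι (initU ε) Q.* (ε Q.÷ ι 2)
  initU-δ = begin
    1ℚ                              ≡⟨ x*δ≡1 ⟨
    x Q.* (ε Q.÷ ι 2)               ≤⟨ *-monoʳ-≤-0≤ (ε Q.÷ ι 2) (0≤-* 0≤ε (QP.≤ᵇ⇒≤ tt)) x≤u ⟩
    ι (initU ε) Q.* (ε Q.÷ ι 2)     ∎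
    where
    open QP.≤-Reasoning
    x≤u : x Q.≤ ι (initU ε)
    x≤u = QP.≤-trans x≤c (ι-mono-≤ (n≤2^⌈log₂n⌉ c))
    x*δ≡1 : x Q.* (ε Q.÷ ι 2) ≡ 1ℚ
    x*δ≡1 = trans (sym (QP.*-assoc x ε (Q.1/ ι 2))) (trans (cong (Q._* Q.1/ ι 2) x*ε≡2) (QP.*-inverseʳ (ι 2)))

  initU-ε : ε Q.≤ 1ℚ → ι (initU ε) Q.* ε Q.≤ ι 6
  initU-ε ε≤1 = begin
    ι (initU ε) Q.* ε
      ≤⟨ *-monoʳ-≤-0≤ ε 0≤ε (ι-mono-≤ (<⇒≤ (2^⌈log₂n⌉<2*n c {{c≢0}}))) ⟩
    ι (2 * c) Q.* ε                      ≡⟨ cong (Q._* ε) (ι-* 2 c) ⟩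
    ι 2 Q.* ι c Q.* ε                    ≤⟨ *-monoʳ-≤-0≤ ε 0≤ε (*-monoˡ-≤-0≤ (ι 2) (0≤ι 2) c≤x+1) ⟩
    ι 2 Q.* (x Q.+ 1ℚ) Q.* ε             ≡⟨ solve 3 (λ a x e → a :* (x :+ con 1ℚ) :* e := a :* (x :* e) :+ a :* e)
                                                  refl (ι 2) x ε ⟩
    ι 2 Q.* (x Q.* ε) Q.+ ι 2 Q.* ε      ≡⟨ cong (λ y → ι 2 Q.* y Q.+ ι 2 Q.* ε) x*ε≡2 ⟩
    ι 2 Q.* ι 2 Q.+ ι 2 Q.* ε            ≤⟨ QP.+-monoʳ-≤ (ι 2 Q.* ι 2) (*-monoˡ-≤-0≤ (ι 2) (0≤ι 2) ε≤1) ⟩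
    ι 2 Q.* ι 2 Q.+ ι 2 Q.* 1ℚ           ≡⟨⟩
    ι 6                                  ∎
    where
    open QP.≤-Reasoning
    open ℚ-Solver

-- Initial radius and total cost

ι-scale : ∀ {ε} u c m n → ε Q.≤ 1ℚ → 0ℚ Q.≤ ε → ι u Q.* ε Q.≤ ι c →
          ι (u * m + n) Q.* ε Q.≤ ι (c * m + n)
ι-scale {ε} u c m n ε≤1 0≤ε uε≤c = begin
  ι (u * m + n) Q.* ε                ≡⟨ cong (Q._* ε) (trans (ι-+ (u * m) n) (cong (Q._+ ι n) (ι-* u m))) ⟩
  (ι u Q.* ι m Q.+ ι n) Q.* ε        ≡⟨ solve 4 (λ u m n e → (u :* m :+ n) :* e := u :* e :* m :+ n :* e)
                                              refl (ι u) (ι m) (ι n) ε ⟩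
  ι u Q.* ε Q.* ι m Q.+ ι n Q.* ε
    ≤⟨ QP.+-mono-≤ (*-monoʳ-≤-0≤ (ι m) (0≤ι m) uε≤c) (*-monoˡ-≤-0≤ (ι n) (0≤ι n) ε≤1) ⟩
  ι c Q.* ι m Q.+ ι n Q.* 1ℚ         ≡⟨ cong₂ Q._+_ (ι-* c m) (sym (QP.*-identityʳ (ι n))) ⟨
  ι (c * m) Q.+ ι n                  ≡⟨ ι-+ (c * m) n ⟨
  ι (c * m + n)                      ∎
  where
  open QP.≤-Reasoning
  open ℚ-Solver

cost-polynomial : ∀ n k .{{_ : N.NonZero n}} .{{_ : N.NonZero k}} →
                  6 * (n + k * suc (12 * n * suc (suc k))) + n ≤ 229 * n * k * k
cost-polynomial n k = begin
  6 * (n + k * suc (12 * n * suc (suc k))) + n                                ≡⟨ expand n k ⟩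
  7 * n + 6 * k + 144 * (n * k) + 72 * (n * k * k)
    ≤⟨ +-monoˡ-≤ (72 * (n * k * k))
         (+-mono-≤ (+-mono-≤ (*-monoʳ-≤ 7 n≤nkk) (*-monoʳ-≤ 6 k≤nkk)) (*-monoʳ-≤ 144 nk≤nkk)) ⟩
  7 * (n * k * k) + 6 * (n * k * k) + 144 * (n * k * k) + 72 * (n * k * k)   ≡⟨ collect n k ⟩
  229 * n * k * k                                                             ∎
  where
  open ≤-Reasoning
  expand : ∀ n k → 6 * (n + k * suc (12 * n * suc (suc k))) + n
                   ≡ 7 * n + 6 * k + 144 * (n * k) + 72 * (n * k * k)
  expand = solve-∀
  collect : ∀ n k → 7 * (n * k * k) + 6 * (n * k * k) + 144 * (n * k * k) + 72 * (n * k * k)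
                    ≡ 229 * n * k * k
  collect = solve-∀
  nk≤nkk : n * k ≤ n * k * k
  nk≤nkk = m≤m*n (n * k) k
  n≤nkk : n ≤ n * k * k
  n≤nkk = ≤-trans (m≤m*n n k) nk≤nkk
  k≤nkk : k ≤ n * k * k
  k≤nkk = ≤-trans (m≤n*m k n) nk≤nkk

runningTime≤ : ∀ k ε .{{_ : NonZero ε}} → 0ℚ Q.< ε → ε Q.≤ 1ℚ →
               Any (_≤ 2 ^ k * initU ε + 2 ^ k + k * initU ε * iterationBound (2 ^ k) (suc k))
                   (runningTime (2 ^ k) ε)
runningTime≤ k ε 0<ε ε≤1 =
  Any-mapMaybe (λ L≤ → +-monoʳ-≤ (n * u + n) (≤-trans L≤ (*-monoˡ-≤ (iterationBound n (suc k)) J≤ku)))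
    (loopCost≤ 0≤δ δ≤1 (⌈log₂1+2^k⌉≤1+k k) J n J≤n (initial-invariant n u (m^n>0 2 p)) enough)
  where
  n p u J : ℕ
  n = 2 ^ k
  p = ⌈log₂ toℕ₀ (Q.ceiling (ι 2 Q.÷ ε)) ⌉
  u = initU ε
  -- The radius starts at u = 2^p and doubles every u iterations, so (k ∸ p)·u
  -- iterations take it past n = 2^k.
  J = (k ∸ p) * u
  δ : ℚ
  δ = ε Q.÷ ι 2
  0≤δ : 0ℚ Q.≤ δ
  0≤δ = 0≤-* (QP.<⇒≤ 0<ε) (QP.≤ᵇ⇒≤ tt)
  δ≤1 : δ Q.≤ 1ℚ
  δ≤1 = QP.≤-trans (*-monoʳ-≤-0≤ (Q.1/ ι 2) (QP.≤ᵇ⇒≤ tt) ε≤1) (QP.≤ᵇ⇒≤ tt)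
  J≤n : J ≤ n
  J≤n = [m∸n]*2^n≤2^m k p
  J≤ku : J ≤ k * u
  J≤ku = *-monoˡ-≤ u (m∸n≤m k p)
  n/2≤n : ι n Q.÷ ι 2 Q.≤ ι n
  n/2≤n = QP.≤-trans (*-monoˡ-≤-0≤ (ι n) (0≤ι n) (QP.≤ᵇ⇒≤ tt)) (QP.≤-reflexive (QP.*-identityʳ (ι n)))
  enough : ι n Q.÷ ι 2 Q.≤ grow δ J (ι u)
  enough = QP.≤-trans n/2≤n (enough-iterations 0≤δ k p (initU-δ ε 0<ε))

runningTime*ε≤ : ∀ k .{{_ : N.NonZero k}} ε .{{_ : NonZero ε}} → 0ℚ Q.< ε → ε Q.≤ 1ℚ →
                 Any (λ t → ι t Q.* ε Q.≤ ι (229 * 2 ^ k * k * k)) (runningTime (2 ^ k) ε)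
runningTime*ε≤ k ε 0<ε ε≤1 = Any.map scale (runningTime≤ k ε 0<ε ε≤1)
  where
  n u I : ℕ
  n = 2 ^ k
  u = initU ε
  I = iterationBound n (suc k)
  regroup : ∀ n u k I → n * u + n + k * u * I ≡ u * (n + k * I) + n
  regroup = solve-∀
  scale : ∀ {t} → t ≤ n * u + n + k * u * I → ι t Q.* ε Q.≤ ι (229 * n * k * k)
  scale {t} t≤ = begin
    ι t Q.* ε                         ≤⟨ *-monoʳ-≤-0≤ ε (QP.<⇒≤ 0<ε) (ι-mono-≤ t≤) ⟩
    ι (n * u + n + k * u * I) Q.* ε   ≡⟨ cong (λ m → ι m Q.* ε) (regroup n u k I) ⟩
    ι (u * (n + k * I) + n) Q.* ε     ≤⟨ ι-scale u 6 (n + k * I) n ε≤1 (QP.<⇒≤ 0<ε) (initU-ε ε 0<ε ε≤1) ⟩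
    ι (6 * (n + k * I) + n)           ≤⟨ ι-mono-≤ (cost-polynomial n k {{m^n≢0 2 k}}) ⟩
    ι (229 * n * k * k)               ∎
    where open QP.≤-Reasoning

mainTheorem3 : ∃[ C ] ∃[ N₀ ] ∀ (k : ℕ) → N₀ N.≤ k →
    ∀ (ε : ℚ) .{{_ : NonZero ε}} → 0ℚ Q.< ε → ε Q.≤ ½ →
    ∃[ t ] (runningTime (2 ^ k) ε ≡ just t
    × ι t Q.* ε Q.≤ ι (C * 2 ^ k * k * k))
mainTheorem3 = 229 , 1 , λ k 1≤k ε 0<ε ε≤½ →
  Any⇒∃ (runningTime*ε≤ k {{N.>-nonZero 1≤k}} ε 0<ε (QP.≤-trans ε≤½ (QP.≤ᵇ⇒≤ tt)))
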